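{- For all integers $n\ge 1$ and $0 \leq m \leq n-1$, the space $\mathrm{Gr}^{\mathrm{var}\leq m}_{1,n}$, with its regular CW structure given by the cells $U_\omega$, collapses onto (a subcomplex homeomorphic to) $\mathbb{RP}^m$; in particular $\mathrm{Gr}^{\mathrm{var}\leq m}_{1,n}$ is (simple) homotopy equivalent to $\mathbb{RP}^m$.
   Context: For $v\in\mathbb{R}^n$, $\mathrm{sgn}(v)\in\{ -,0,+\}^n$ is the vector of signs of its entries, considered up to global negation. The sign variation $\mathrm{var}(v)$ is the number of sign changes in the entries of $v$ after deleting zeros. $\mathrm{Gr}^{\mathrm{var}\leq m}_{1,n}=\{v\in\mathbb{RP}^{n-1}:\mathrm{var}(v)\le m\}$, a regular CW complex whose open cells are $U_\omega=\{v\in\mathbb{RP}^{n-1}:\mathrm{sgn}(v)=\omega\}$ for nonzero sign vectors $\omega$ with $\mathrm{var}(\omega)\le m$. Collapsing ($\searrow$) means reduction by a sequence of elementary collapses (removing a free face together with the unique cell containing it), which is a simple homotopy equivalence. -}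

module Defs where

open import Data.Nat using (ℕ; zero; suc; _+_; _≤ᵇ_)
open import Data.Bool using (Bool; true; false; _∧_)
open import Data.Maybe using (Maybe; just; nothing)
open import Data.Vec using (Vec; []; _∷_; map)
open import Data.Product using (Σ; _×_; _,_)
open import Data.Sum using (_⊎_)
open import Relation.Binary.PropositionalEquality using (_≡_; _≢_; refl)
open import Relation.Nullary using (Dec; yes; no)

data Sign : Set where
  ⊖ 𝟘 ⊕ : Sign

_≟ˢ_ : (s t : Sign) → Dec (s ≡ t)
⊖ ≟ˢ ⊖ = yes refl
⊖ ≟ˢ 𝟘 = no λ ()
⊖ ≟ˢ ⊕ = no λ ()
𝟘 ≟ˢ ⊖ = no λ ()
𝟘 ≟ˢ 𝟘 = yes refl
𝟘 ≟ˢ ⊕ = no λ ()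
⊕ ≟ˢ ⊖ = no λ ()
⊕ ≟ˢ 𝟘 = no λ ()
⊕ ≟ˢ ⊕ = yes refl

_≟ᵛ_ : ∀ {n} (x y : Vec Sign n) → Dec (x ≡ y)
[] ≟ᵛ [] = yes refl
(s ∷ xs) ≟ᵛ (t ∷ ys) with s ≟ˢ t | xs ≟ᵛ ys
... | yes refl | yes refl = yes refl
... | no s≢t   | _        = no λ { refl → s≢t refl }
... | yes _    | no ne    = no λ { refl → ne refl }

negˢ : Sign → Sign
negˢ ⊖ = ⊕
negˢ 𝟘 = 𝟘
negˢ ⊕ = ⊖

negᵛ : ∀ {n} → Vec Sign n → Vec Sign n
negᵛ = map negˢ

-- Sign variation: number of sign changes after deleting zeros.
-- The first argument is the last nonzero sign seen so far (if any).
varAux : ∀ {n} → Maybe Sign → Vec Sign n → ℕ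
varAux last [] = 0
varAux last (𝟘 ∷ xs) = varAux last xs
varAux nothing (s ∷ xs) = varAux (just s) xs
varAux (just ⊖) (⊖ ∷ xs) = varAux (just ⊖) xs
varAux (just ⊕) (⊕ ∷ xs) = varAux (just ⊕) xs
varAux (just ⊖) (⊕ ∷ xs) = suc (varAux (just ⊕) xs)
varAux (just ⊕) (⊖ ∷ xs) = suc (varAux (just ⊖) xs)
varAux (just 𝟘) (s ∷ xs) = varAux (just s) xs   -- never reached

var : ∀ {n} → Vec Sign n → ℕ
var = varAux nothing

-- Sign vectors are taken up to global negation; we use the canonical
-- representative whose first nonzero entry is ⊕.
isCell : ∀ {n} → Vec Sign n → Bool
isCell [] = false
isCell (𝟘 ∷ xs) = isCell xs
isCell (⊕ ∷ xs) = true
isCell (⊖ ∷ xs) = false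

IsCell : ∀ {n} → Vec Sign n → Set
IsCell x = isCell x ≡ true

-- number of nonzero entries (= dimension of U_ω plus one)
supp : ∀ {n} → Vec Sign n → ℕ
supp [] = 0
supp (𝟘 ∷ xs) = supp xs
supp (⊖ ∷ xs) = suc (supp xs)
supp (⊕ ∷ xs) = suc (supp xs)

-- Face relation: closure of U_ω consists of U_τ with τ obtained from
-- ω or from -ω by zeroing some entries.

data _≤ˢ_ : Sign → Sign → Set where
  z≤ : ∀ {s} → 𝟘 ≤ˢ s
  s≤s : ∀ {s} → s ≤ˢ s

data _≤ᵛ_ : ∀ {n} → Vec Sign n → Vec Sign n → Set where
  []≤[] : [] ≤ᵛ []
  _∷≤_  : ∀ {n s t} {xs ys : Vec Sign n} → s ≤ˢ t → xs ≤ᵛ ys → (s ∷ xs) ≤ᵛ (t ∷ ys)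

_≼_ : ∀ {n} → Vec Sign n → Vec Sign n → Set
τ ≼ ω = (τ ≤ᵛ ω) ⊎ (τ ≤ᵛ negᵛ ω)

_≺_ : ∀ {n} → Vec Sign n → Vec Sign n → Set
τ ≺ ω = (τ ≼ ω) × (τ ≢ ω)

-- A set of cells of RP^{n-1}, given by its characteristic function
-- (only its values on cells matter).
Complex : ℕ → Set
Complex n = Vec Sign n → Bool

GrVar : (n m : ℕ) → Complex n
GrVar n m x = isCell x ∧ (var x ≤ᵇ m)

record FreeFace {n} (K : Complex n) (σ τ : Vec Sign n) : Set where
  field
    σ-cell : IsCell σ
    τ-cell : IsCell τ
    σ∈K    : K σ ≡ true
    τ∈K    : K τ ≡ true
    σ≺τ    : σ ≺ τ
    codim1 : supp τ ≡ suc (supp σ)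
    unique : ∀ ρ → IsCell ρ → K ρ ≡ true → σ ≺ ρ → ρ ≡ τ

remove : ∀ {n} → Complex n → Vec Sign n → Vec Sign n → Complex n
remove K σ τ x with x ≟ᵛ σ | x ≟ᵛ τ
... | yes _ | _     = false
... | no _  | yes _ = false
... | no _  | no _  = K x

_≈ᶜ_ : ∀ {n} → Complex n → Complex n → Set
K ≈ᶜ L = ∀ x → IsCell x → K x ≡ L x

data _↘_ {n} : Complex n → Complex n → Set where
  done : ∀ {K L} → K ≈ᶜ L → K ↘ L
  step : ∀ {K L} σ τ → FreeFace K σ τ → remove K σ τ ↘ L → K ↘ L

-- The standard regular CW structure on
-- RP^m has as cells the nonzero sign vectors of length m+1 up to sign,
-- i.e. the cells of Vec Sign (suc m); a regular CW complex is determined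
-- up to homeomorphism by its face poset.

CellsOf : ∀ {n} → Complex n → Set
CellsOf {n} K = Σ (Vec Sign n) λ x → IsCell x × (K x ≡ true)

RPCells : ℕ → Set
RPCells m = Σ (Vec Sign (suc m)) IsCell

record FacePosetIsoRP {n} (L : Complex n) (m : ℕ) : Set where
  field
    to      : CellsOf L → RPCells m
    from    : RPCells m → CellsOf L
    to-from : ∀ y → Σ.proj₁ (to (from y)) ≡ Σ.proj₁ y
    from-to : ∀ x → Σ.proj₁ (from (to x)) ≡ Σ.proj₁ x
    mono    : ∀ a b → Σ.proj₁ a ≼ Σ.proj₁ b → Σ.proj₁ (to a) ≼ Σ.proj₁ (to b)
    reflect : ∀ a b → Σ.proj₁ (to a) ≼ Σ.proj₁ (to b) → Σ.proj₁ a ≼ Σ.proj₁ b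

module Submission where

-- For
-- m < N the cells of Gr^{var≤m}_{1,N+1} with first entry ⊕ are the vectors
-- ⊕ ∷ y with var(⊕ ∷ y) ≤ m, and every coface of such a cell again starts
-- with ⊕.  If this set of tails y can be emptied by removing pairs σ < τ in
-- which τ is the only remaining element above σ ("is clearable"), then
-- Gr^{var≤m}_{1,N+1} collapses onto the copy of Gr^{var≤m}_{1,N} in the
-- hyperplane x₁ = 0.  Iterating down to N = m+1, where every cell has at most
-- m sign changes, leaves all of RP^m.
--
-- Clearability is developed for arbitrary subsets of the poset Sign^N: it is
-- transported along order embeddings, it is closed under unions in which no
-- element of the first part lies below the second, and cylinders {𝟘,ε} × A
-- are clearable.  The tail sets {y : var(ε ∷ y) ≤ m} split into such pieces,
-- which gives their clearability by induction on m.

open import Defs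
open import Data.Nat using (ℕ; zero; suc; _+_; _≤_; _<_; _≤ᵇ_; z≤n; s≤s)
open import Data.Nat.Properties using (m≤n⇒m≤1+n; +-suc; ≤⇒≤ᵇ; m<1+n⇒m<n∨m≡n)
open import Data.Bool using (true; false; _∧_; _∨_)
open import Data.Bool.Properties using (∨-identityʳ; ∧-zeroʳ; T-≡)
open import Data.Maybe using (just; nothing)
open import Data.Vec using (Vec; []; _∷_; head)
open import Data.Product using (Σ; ∃; _×_; _,_; proj₁; proj₂)
open import Data.Sum using (_⊎_; inj₁; inj₂; [_,_])
open import Data.Empty using (⊥-elim)
open import Function.Bundles using (Equivalence)
open import Relation.Binary.PropositionalEquality using (_≡_; _≢_; refl; sym; trans; cong; module ≡-Reasoning)
open import Relation.Nullary using (Dec; yes; no; does; ¬_)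
open import Relation.Nullary.Decidable using (dec-true)

does-∧ : ∀ {P : Set} (d : Dec P) {b} → does d ∧ b ≡ true → P × b ≡ true
does-∧ (yes p) h = p , h
does-∧ (no _) ()

∨-true : ∀ a {b} → a ∨ b ≡ true → a ≡ true ⊎ b ≡ true
∨-true true _ = inj₁ refl
∨-true false h = inj₂ h

not-true : ∀ {b} → ¬ (b ≡ true) → b ≡ false
not-true {false} _ = refl
not-true {true} h = ⊥-elim (h refl)

suc-≤ᵇ : ∀ a b → (suc a ≤ᵇ suc b) ≡ (a ≤ᵇ b)
suc-≤ᵇ zero b = refl
suc-≤ᵇ (suc a) b = refl

≤⇒≤ᵇ-true : ∀ {a b} → a ≤ b → (a ≤ᵇ b) ≡ true
≤⇒≤ᵇ-true a≤b = Equivalence.to T-≡ (≤⇒≤ᵇ a≤b)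

remove-σ : ∀ {n} (K : Complex n) σ τ → remove K σ τ σ ≡ false
remove-σ K σ τ with σ ≟ᵛ σ | σ ≟ᵛ τ
... | yes _ | _ = refl
... | no σ≢σ | _ = ⊥-elim (σ≢σ refl)

remove-τ : ∀ {n} (K : Complex n) σ τ → remove K σ τ τ ≡ false
remove-τ K σ τ with τ ≟ᵛ σ | τ ≟ᵛ τ
... | yes _ | _ = refl
... | no _ | yes _ = refl
... | no _ | no τ≢τ = ⊥-elim (τ≢τ refl)

remove-other : ∀ {n} (K : Complex n) σ τ x → x ≢ σ → x ≢ τ → remove K σ τ x ≡ K x
remove-other K σ τ x x≢σ x≢τ with x ≟ᵛ σ | x ≟ᵛ τ
... | yes x≡σ | _ = ⊥-elim (x≢σ x≡σ)
... | no _ | yes x≡τ = ⊥-elim (x≢τ x≡τ)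
... | no _ | no _ = refl

remove-⊆ : ∀ {n} (K : Complex n) σ τ x → remove K σ τ x ≡ true → K x ≡ true
remove-⊆ K σ τ x with x ≟ᵛ σ | x ≟ᵛ τ
... | yes _ | _ = λ ()
... | no _ | yes _ = λ ()
... | no _ | no _ = λ h → h

remove-relabel : ∀ {n k} (K : Complex n) (K' : Complex k) (f : Vec Sign k → Vec Sign n) →
  (∀ {u v} → f u ≡ f v → u ≡ v) → ∀ σ τ x → K (f x) ≡ K' x →
  remove K (f σ) (f τ) (f x) ≡ remove K' σ τ x
remove-relabel K K' f f-inj σ τ x Kfx≡K'x = by-cases (x ≟ᵛ σ) (x ≟ᵛ τ)
  where
  by-cases : Dec (x ≡ σ) → Dec (x ≡ τ) → remove K (f σ) (f τ) (f x) ≡ remove K' σ τ x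
  by-cases (yes refl) _ = trans (remove-σ K (f x) (f τ)) (sym (remove-σ K' x τ))
  by-cases (no _) (yes refl) = trans (remove-τ K (f σ) (f x)) (sym (remove-τ K' σ x))
  by-cases (no x≢σ) (no x≢τ) = begin
    remove K (f σ) (f τ) (f x) ≡⟨ remove-other K (f σ) (f τ) (f x) (λ e → x≢σ (f-inj e)) (λ e → x≢τ (f-inj e)) ⟩
    K (f x)                    ≡⟨ Kfx≡K'x ⟩
    K' x                       ≡⟨ sym (remove-other K' σ τ x x≢σ x≢τ) ⟩
    remove K' σ τ x            ∎
    where open ≡-Reasoning

data Nonzero : Sign → Set where
  ⊕≢𝟘 : Nonzero ⊕
  ⊖≢𝟘 : Nonzero ⊖

𝟘≢nonzero : ∀ {ε} → Nonzero ε → 𝟘 ≢ ε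
𝟘≢nonzero ⊕≢𝟘 ()
𝟘≢nonzero ⊖≢𝟘 ()

nonzero-neg : ∀ {ε} → Nonzero ε → Nonzero (negˢ ε)
nonzero-neg ⊕≢𝟘 = ⊖≢𝟘
nonzero-neg ⊖≢𝟘 = ⊕≢𝟘

neg-≰ : ∀ {ε} → Nonzero ε → ¬ (negˢ ε ≤ˢ ε)
neg-≰ ⊕≢𝟘 ()
neg-≰ ⊖≢𝟘 ()

≤ˢ-trans : ∀ {s t u} → s ≤ˢ t → t ≤ˢ u → s ≤ˢ u
≤ˢ-trans z≤ _ = z≤
≤ˢ-trans s≤s t≤u = t≤u

_≤ˢ?_ : (s t : Sign) → Dec (s ≤ˢ t)
s ≤ˢ? t with s ≟ˢ 𝟘 | s ≟ˢ t
... | yes refl | _ = yes z≤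
... | no _ | yes refl = yes s≤s
... | no s≢𝟘 | no s≢t = no λ { z≤ → s≢𝟘 refl ; s≤s → s≢t refl }

≤ᵛ-refl : ∀ {n} (x : Vec Sign n) → x ≤ᵛ x
≤ᵛ-refl [] = []≤[]
≤ᵛ-refl (s ∷ x) = s≤s ∷≤ ≤ᵛ-refl x

suppˢ : Sign → ℕ
suppˢ 𝟘 = 0
suppˢ ⊕ = 1
suppˢ ⊖ = 1

supp-cons : ∀ {n} s (x : Vec Sign n) → supp (s ∷ x) ≡ suppˢ s + supp x
supp-cons 𝟘 x = refl
supp-cons ⊕ x = refl
supp-cons ⊖ x = refl

supp-insert₂ : ∀ {n} a t (w : Vec Sign n) → supp (a ∷ t ∷ w) ≡ suppˢ t + supp (a ∷ w)
supp-insert₂ 𝟘 t w = supp-cons t w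
supp-insert₂ ⊕ 𝟘 w = refl
supp-insert₂ ⊕ ⊕ w = refl
supp-insert₂ ⊕ ⊖ w = refl
supp-insert₂ ⊖ 𝟘 w = refl
supp-insert₂ ⊖ ⊕ w = refl
supp-insert₂ ⊖ ⊖ w = refl

supp-single : ∀ {ε} → Nonzero ε → supp (ε ∷ []) ≡ 1
supp-single ⊕≢𝟘 = refl
supp-single ⊖≢𝟘 = refl

-- Whenever S is the set of tails of an up-closed family of cells, this is a
-- sequence of elementary collapses.

record FreePair {N} (S : Complex N) (σ τ : Vec Sign N) : Set where
  field
    σ∈S    : S σ ≡ true
    τ∈S    : S τ ≡ true
    σ≤τ    : σ ≤ᵛ τ
    σ≢τ    : σ ≢ τ
    codim1 : supp τ ≡ suc (supp σ)
    unique : ∀ ρ → S ρ ≡ true → σ ≤ᵛ ρ → σ ≢ ρ → ρ ≡ τ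

data Clearable {N} (S : Complex N) : Set where
  empty : (∀ y → S y ≡ false) → Clearable S
  pair  : ∀ σ τ → FreePair S σ τ → Clearable (remove S σ τ) → Clearable S

-- Order embeddings Sign^N → Sign^M shifting the support size by a constant;
-- they carry free pairs to free pairs.
record SignEmbedding (N M : ℕ) : Set where
  field
    embed      : Vec Sign N → Vec Sign M
    injective  : ∀ {x y} → embed x ≡ embed y → x ≡ y
    monotone   : ∀ {x y} → x ≤ᵛ y → embed x ≤ᵛ embed y
    reflecting : ∀ {x y} → embed x ≤ᵛ embed y → x ≤ᵛ y
    shift      : ℕ
    supp-embed : ∀ x → supp (embed x) ≡ shift + supp x

record Image {N M} (e : SignEmbedding N M) (S : Complex N) (T : Complex M) : Set where
  field
    on-image : ∀ x → T (SignEmbedding.embed e x) ≡ S x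
    onto     : ∀ y → T y ≡ true → ∃ λ x → SignEmbedding.embed e x ≡ y

module _ {N M} (e : SignEmbedding N M) where
  open SignEmbedding e

  remove-Image : ∀ {S T} σ τ → Image e S T → Image e (remove S σ τ) (remove T (embed σ) (embed τ))
  remove-Image {S} {T} σ τ im = record
    { on-image = λ x → remove-relabel T S embed injective σ τ x (Image.on-image im x)
    ; onto     = λ y h → Image.onto im y (remove-⊆ T (embed σ) (embed τ) y h) }

  freePair-Image : ∀ {S T σ τ} → Image e S T → FreePair S σ τ → FreePair T (embed σ) (embed τ)
  freePair-Image {S} {T} {σ} {τ} im fp = record
    { σ∈S    = trans (on-image σ) σ∈S
    ; τ∈S    = trans (on-image τ) τ∈S
    ; σ≤τ    = monotone σ≤τ
    ; σ≢τ    = λ eq → σ≢τ (injective eq)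
    ; codim1 = codim1-embed
    ; unique = unique-embed }
    where
    open FreePair fp
    open Image im
    codim1-embed : supp (embed τ) ≡ suc (supp (embed σ))
    codim1-embed = begin
      supp (embed τ)         ≡⟨ supp-embed τ ⟩
      shift + supp τ         ≡⟨ cong (shift +_) codim1 ⟩
      shift + suc (supp σ)   ≡⟨ +-suc shift (supp σ) ⟩
      suc (shift + supp σ)   ≡⟨ cong suc (sym (supp-embed σ)) ⟩
      suc (supp (embed σ))   ∎
      where open ≡-Reasoning
    unique-embed : ∀ ρ → T ρ ≡ true → embed σ ≤ᵛ ρ → embed σ ≢ ρ → ρ ≡ embed τ
    unique-embed ρ Tρ σ≤ρ σ≢ρ with onto ρ Tρ
    ... | x , refl = cong embed (unique x (trans (sym (on-image x)) Tρ) (reflecting σ≤ρ) (λ eq → σ≢ρ (cong embed eq)))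

  clearable-Image : ∀ {S T} → Image e S T → Clearable S → Clearable T
  clearable-Image {S} {T} im (empty S-empty) = empty λ y → not-true (absent y)
    where
    absent : ∀ y → ¬ (T y ≡ true)
    absent y Ty with Image.onto im y Ty
    ... | x , refl with () ← trans (sym Ty) (trans (Image.on-image im x) (S-empty x))
  clearable-Image im (pair σ τ fp rest) =
    pair (embed σ) (embed τ) (freePair-Image im fp) (clearable-Image (remove-Image σ τ im) rest)

idEmbedding : ∀ {N} → SignEmbedding N N
idEmbedding = record
  { embed = λ x → x ; injective = λ eq → eq ; monotone = λ le → le ; reflecting = λ le → le
  ; shift = 0 ; supp-embed = λ _ → refl }

clearable-resp : ∀ {N} {S T : Complex N} → Clearable S → (∀ x → T x ≡ S x) → Clearable T
clearable-resp c T≡S = clearable-Image idEmbedding (record { on-image = T≡S ; onto = λ y _ → y , refl }) c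

prefix : ∀ {N} → Sign → SignEmbedding N (suc N)
prefix t = record
  { embed = t ∷_ ; injective = λ { refl → refl } ; monotone = s≤s ∷≤_ ; reflecting = λ { (_ ∷≤ le) → le }
  ; shift = suppˢ t ; supp-embed = supp-cons t }

_∷ᶜ_ : ∀ {N} → Sign → Complex N → Complex (suc N)
(t ∷ᶜ B) (s ∷ z) = does (s ≟ˢ t) ∧ B z

prefix-Image : ∀ {N} t (B : Complex N) → Image (prefix t) B (t ∷ᶜ B)
prefix-Image t B = record { on-image = λ z → cong (_∧ B z) (dec-true (t ≟ˢ t) refl) ; onto = onto }
  where
  onto : ∀ y → (t ∷ᶜ B) y ≡ true → ∃ λ z → t ∷ z ≡ y
  onto (s ∷ z) h with proj₁ (does-∧ (s ≟ˢ t) h)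
  ... | refl = z , refl

insert₂ : ∀ {N} → Sign → Vec Sign (suc N) → Vec Sign (suc (suc N))
insert₂ t (a ∷ w) = a ∷ t ∷ w

insertion : ∀ {N} → Sign → SignEmbedding (suc N) (suc (suc N))
insertion {N} t = record
  { embed = insert₂ t ; injective = injective ; monotone = monotone ; reflecting = reflecting
  ; shift = suppˢ t ; supp-embed = λ { (a ∷ w) → supp-insert₂ a t w } }
  where
  injective : ∀ {x y : Vec Sign (suc N)} → insert₂ t x ≡ insert₂ t y → x ≡ y
  injective {_ ∷ _} {_ ∷ _} refl = refl
  monotone : ∀ {x y : Vec Sign (suc N)} → x ≤ᵛ y → insert₂ t x ≤ᵛ insert₂ t y
  monotone (a≤b ∷≤ le) = a≤b ∷≤ (s≤s ∷≤ le)
  reflecting : ∀ {x y : Vec Sign (suc N)} → insert₂ t x ≤ᵛ insert₂ t y → x ≤ᵛ y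
  reflecting {_ ∷ _} {_ ∷ _} (a≤b ∷≤ (_ ∷≤ le)) = a≤b ∷≤ le

insert₂ᶜ : ∀ {N} → Sign → Complex (suc N) → Complex (suc (suc N))
insert₂ᶜ t S (a ∷ y) = (t ∷ᶜ λ w → S (a ∷ w)) y

insertion-Image : ∀ {N} t (S : Complex (suc N)) → Image (insertion t) S (insert₂ᶜ t S)
insertion-Image t S = record
  { on-image = λ { (a ∷ w) → cong (_∧ S (a ∷ w)) (dec-true (t ≟ˢ t) refl) } ; onto = onto }
  where
  onto : ∀ y → insert₂ᶜ t S y ≡ true → ∃ λ x → insert₂ t x ≡ y
  onto (a ∷ s ∷ w) h with proj₁ (does-∧ (s ≟ˢ t) h)
  ... | refl = a ∷ w , refl

-- Unions.  If nothing in S₁ lies below S₂, the cofaces of S₁ inside S₁ ∪ S₂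
-- stay in S₁, so S₁ can be cleared first and S₂ afterwards.

_∪_ : ∀ {N} → Complex N → Complex N → Complex N
(S₁ ∪ S₂) y = S₁ y ∨ S₂ y

NoneBelow : ∀ {N} → Complex N → Complex N → Set
NoneBelow S₁ S₂ = ∀ a b → S₁ a ≡ true → S₂ b ≡ true → ¬ (a ≤ᵛ b)

noneBelow-∪ : ∀ {N} {S₁ S₂ S₃ : Complex N} → NoneBelow S₁ S₃ → NoneBelow S₂ S₃ → NoneBelow (S₁ ∪ S₂) S₃
noneBelow-∪ {S₁ = S₁} nb₁ nb₂ a b h with ∨-true (S₁ a) h
... | inj₁ h₁ = nb₁ a b h₁
... | inj₂ h₂ = nb₂ a b h₂

remove-∪ : ∀ {N} (S₁ S₂ : Complex N) σ τ → S₂ σ ≡ false → S₂ τ ≡ false →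
  ∀ x → remove (S₁ ∪ S₂) σ τ x ≡ (remove S₁ σ τ ∪ S₂) x
remove-∪ S₁ S₂ σ τ σ∉S₂ τ∉S₂ x with x ≟ᵛ σ | x ≟ᵛ τ
... | yes refl | _ = sym σ∉S₂
... | no _ | yes refl = sym τ∉S₂
... | no _ | no _ = refl

clearable-∪ : ∀ {N} {S₁ S₂ : Complex N} → Clearable S₁ → Clearable S₂ → NoneBelow S₁ S₂ → Clearable (S₁ ∪ S₂)
clearable-∪ {S₂ = S₂} (empty S₁-empty) c₂ _ = clearable-resp c₂ (λ y → cong (_∨ S₂ y) (S₁-empty y))
clearable-∪ {S₁ = S₁} {S₂} (pair σ τ fp rest) c₂ nb =
  pair σ τ fp-∪ (clearable-resp (clearable-∪ rest c₂ nb-rest) (remove-∪ S₁ S₂ σ τ (outside σ σ∈S) (outside τ τ∈S)))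
  where
  open FreePair fp
  outside : ∀ x → S₁ x ≡ true → S₂ x ≡ false
  outside x h₁ = not-true λ h₂ → nb x x h₁ h₂ (≤ᵛ-refl x)
  unique-∪ : ∀ ρ → (S₁ ∪ S₂) ρ ≡ true → σ ≤ᵛ ρ → σ ≢ ρ → ρ ≡ τ
  unique-∪ ρ h σ≤ρ σ≢ρ with ∨-true (S₁ ρ) h
  ... | inj₁ h₁ = unique ρ h₁ σ≤ρ σ≢ρ
  ... | inj₂ h₂ = ⊥-elim (nb σ ρ σ∈S h₂ σ≤ρ)
  fp-∪ : FreePair (S₁ ∪ S₂) σ τ
  fp-∪ = record
    { σ∈S = cong (_∨ S₂ σ) σ∈S ; τ∈S = cong (_∨ S₂ τ) τ∈S ; σ≤τ = σ≤τ ; σ≢τ = σ≢τ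
    ; codim1 = codim1 ; unique = unique-∪ }
  nb-rest : NoneBelow (remove S₁ σ τ) S₂
  nb-rest a b h = nb a b (remove-⊆ S₁ σ τ a h)

insert₂ᶜ-noneBelow : ∀ {N} {t t'} (S S' : Complex (suc N)) → ¬ (t ≤ˢ t') → NoneBelow (insert₂ᶜ t S) (insert₂ᶜ t' S')
insert₂ᶜ-noneBelow {t = t} {t'} S S' t≰t' (a ∷ s ∷ w) (b ∷ s' ∷ w') h h' (_ ∷≤ (s≤s' ∷≤ _))
  with proj₁ (does-∧ (s ≟ˢ t) h) | proj₁ (does-∧ (s' ≟ˢ t') h')
... | refl | refl = t≰t' s≤s'

slice₂ : ∀ {N} → Sign → Complex (suc (suc N)) → Complex (suc N)
slice₂ t S (a ∷ w) = S (a ∷ t ∷ w)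

split₂ : ∀ {N} (S : Complex (suc (suc N))) x →
  S x ≡ ((insert₂ᶜ ⊕ (slice₂ ⊕ S) ∪ insert₂ᶜ ⊖ (slice₂ ⊖ S)) ∪ insert₂ᶜ 𝟘 (slice₂ 𝟘 S)) x
split₂ S (a ∷ 𝟘 ∷ w) = refl
split₂ S (a ∷ ⊕ ∷ w) = sym (trans (∨-identityʳ _) (∨-identityʳ _))
split₂ S (a ∷ ⊖ ∷ w) = sym (∨-identityʳ _)

Cyl : ∀ {N} → Sign → Complex N → Complex (suc N)
Cyl ε A (s ∷ z) = does (s ≤ˢ? ε) ∧ A z

-- Over a point the cylinder is empty or the single free pair 𝟘 < ε.
cylinder-point : ∀ {ε} → Nonzero ε → (A : Complex 0) → Clearable (Cyl ε A)
cylinder-point {ε} nz A with A [] in A[]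
... | false = empty λ { (s ∷ []) → trans (cong (does (s ≤ˢ? ε) ∧_) A[]) (∧-zeroʳ _) }
... | true = pair σ τ fp (empty emptied)
  where
  σ τ : Vec Sign 1
  σ = 𝟘 ∷ []
  τ = ε ∷ []
  cells : ∀ y → Cyl ε A y ≡ true → y ≡ σ ⊎ y ≡ τ
  cells (s ∷ []) h with proj₁ (does-∧ (s ≤ˢ? ε) h)
  ... | z≤ = inj₁ refl
  ... | s≤s = inj₂ refl
  unique : ∀ ρ → Cyl ε A ρ ≡ true → σ ≤ᵛ ρ → σ ≢ ρ → ρ ≡ τ
  unique ρ h _ σ≢ρ with cells ρ h
  ... | inj₁ refl = ⊥-elim (σ≢ρ refl)
  ... | inj₂ ρ≡τ = ρ≡τ
  fp : FreePair (Cyl ε A) σ τ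
  fp = record
    { σ∈S = trans (cong (_∧ A []) (dec-true (𝟘 ≤ˢ? ε) z≤)) A[]
    ; τ∈S = trans (cong (_∧ A []) (dec-true (ε ≤ˢ? ε) s≤s)) A[]
    ; σ≤τ = z≤ ∷≤ []≤[]
    ; σ≢τ = λ eq → 𝟘≢nonzero nz (cong head eq)
    ; codim1 = supp-single nz
    ; unique = unique }
  emptied : ∀ y → remove (Cyl ε A) σ τ y ≡ false
  emptied y with y ≟ᵛ σ | y ≟ᵛ τ
  ... | yes _ | _ = refl
  ... | no _ | yes _ = refl
  ... | no y≢σ | no y≢τ = not-true λ h → [ y≢σ , y≢τ ] (cells y h)

-- Cylinders {𝟘,ε} × A are clearable, by induction on the length of A: split
-- by the first entry of A and clear the ⊕-slice, the ⊖-slice, then the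
-- 𝟘-slice; no slice lies below an earlier one.
cylinder-clearable : ∀ {ε} → Nonzero ε → ∀ {N} (A : Complex N) → Clearable (Cyl ε A)
cylinder-clearable nz {zero} A = cylinder-point nz A
cylinder-clearable {ε} nz {suc N} A =
  clearable-resp
    (clearable-∪ (clearable-∪ (slice ⊕) (slice ⊖) (insert₂ᶜ-noneBelow _ _ λ ()))
                 (slice 𝟘)
                 (noneBelow-∪ (insert₂ᶜ-noneBelow _ _ λ ()) (insert₂ᶜ-noneBelow _ _ λ ())))
    (split₂ (Cyl ε A))
  where
  slice : ∀ t → Clearable (insert₂ᶜ t (slice₂ t (Cyl ε A)))
  slice t = clearable-Image (insertion t) (insertion-Image t _)
              (clearable-resp (cylinder-clearable nz (λ w → A (t ∷ w))) λ { (a ∷ w) → refl })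

LowVar : Sign → (N m : ℕ) → Complex N
LowVar ε N m y = varAux (just ε) y ≤ᵇ m

-- With no sign change allowed, the first entry of the tail lies in {𝟘,ε}.
lowVar-zero : ∀ {ε} → Nonzero ε → ∀ N x → LowVar ε (suc N) 0 x ≡ Cyl ε (LowVar ε N 0) x
lowVar-zero ⊕≢𝟘 N (𝟘 ∷ z) = refl
lowVar-zero ⊕≢𝟘 N (⊕ ∷ z) = refl
lowVar-zero ⊕≢𝟘 N (⊖ ∷ z) = refl
lowVar-zero ⊖≢𝟘 N (𝟘 ∷ z) = refl
lowVar-zero ⊖≢𝟘 N (⊕ ∷ z) = refl
lowVar-zero ⊖≢𝟘 N (⊖ ∷ z) = refl

-- Otherwise the tail either starts with a sign change to -ε (using up one
-- change), or its first entry lies in {𝟘,ε}.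
lowVar-suc : ∀ {ε} → Nonzero ε → ∀ N m x →
  LowVar ε (suc N) (suc m) x ≡ ((negˢ ε ∷ᶜ LowVar (negˢ ε) N m) ∪ Cyl ε (LowVar ε N (suc m))) x
lowVar-suc ⊕≢𝟘 N m (𝟘 ∷ z) = refl
lowVar-suc ⊕≢𝟘 N m (⊕ ∷ z) = refl
lowVar-suc ⊕≢𝟘 N m (⊖ ∷ z) = trans (suc-≤ᵇ (varAux (just ⊖) z) m) (sym (∨-identityʳ _))
lowVar-suc ⊖≢𝟘 N m (𝟘 ∷ z) = refl
lowVar-suc ⊖≢𝟘 N m (⊖ ∷ z) = refl
lowVar-suc ⊖≢𝟘 N m (⊕ ∷ z) = trans (suc-≤ᵇ (varAux (just ⊕) z) m) (sym (∨-identityʳ _))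

negPrefix-noneBelow : ∀ {ε} → Nonzero ε → ∀ {N} (B A : Complex N) → NoneBelow (negˢ ε ∷ᶜ B) (Cyl ε A)
negPrefix-noneBelow {ε} nz B A (s ∷ z) (s' ∷ z') h h' (s≤s' ∷≤ _) with proj₁ (does-∧ (s ≟ˢ negˢ ε) h)
... | refl = neg-≰ nz (≤ˢ-trans s≤s' (proj₁ (does-∧ (s' ≤ˢ? ε) h')))

lowVar-clearable : ∀ {ε} → Nonzero ε → ∀ m N → m ≤ N → Clearable (LowVar ε (suc N) m)
lowVar-clearable nz zero N _ = clearable-resp (cylinder-clearable nz _) (lowVar-zero nz N)
lowVar-clearable {ε} nz (suc m) (suc N) (s≤s m≤N) =
  clearable-resp
    (clearable-∪ (clearable-Image (prefix (negˢ ε)) (prefix-Image _ _)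
                                  (lowVar-clearable (nonzero-neg nz) m N m≤N))
                 (cylinder-clearable nz _)
                 (negPrefix-noneBelow nz _ _))
    (lowVar-suc nz (suc N) m)

freeFace-resp : ∀ {n} {K L : Complex n} {σ τ} → K ≈ᶜ L → FreeFace L σ τ → FreeFace K σ τ
freeFace-resp K≈L ff = record
  { σ-cell = σ-cell ; τ-cell = τ-cell
  ; σ∈K = trans (K≈L _ σ-cell) σ∈K ; τ∈K = trans (K≈L _ τ-cell) τ∈K
  ; σ≺τ = σ≺τ ; codim1 = codim1
  ; unique = λ ρ c h σ≺ρ → unique ρ c (trans (sym (K≈L ρ c)) h) σ≺ρ }
  where open FreeFace ff

↘-resp : ∀ {n} {K L M : Complex n} → K ≈ᶜ L → L ↘ M → K ↘ M
↘-resp K≈L (done L≈M) = done λ x c → trans (K≈L x c) (L≈M x c)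
↘-resp {K = K} {L} K≈L (step σ τ ff rest) =
  step σ τ (freeFace-resp K≈L ff)
    (↘-resp (λ x c → remove-relabel K L (λ y → y) (λ eq → eq) σ τ x (K≈L x c)) rest)

↘-trans : ∀ {n} {K L M : Complex n} → K ↘ L → L ↘ M → K ↘ M
↘-trans (done K≈L) L↘M = ↘-resp K≈L L↘M
↘-trans (step σ τ ff rest) L↘M = step σ τ ff (↘-trans rest L↘M)

onHyperplane : ∀ {n} → Complex n → Complex (suc n)
onHyperplane K (𝟘 ∷ x) = K x
onHyperplane K (⊕ ∷ x) = false
onHyperplane K (⊖ ∷ x) = false

≼-tail : ∀ {n} {x y : Vec Sign n} → (𝟘 ∷ x) ≼ (𝟘 ∷ y) → x ≼ y
≼-tail (inj₁ (_ ∷≤ x≤y)) = inj₁ x≤y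
≼-tail (inj₂ (_ ∷≤ x≤-y)) = inj₂ x≤-y

≼-cons : ∀ {n} {x y : Vec Sign n} → x ≼ y → (𝟘 ∷ x) ≼ (𝟘 ∷ y)
≼-cons (inj₁ x≤y) = inj₁ (z≤ ∷≤ x≤y)
≼-cons (inj₂ x≤-y) = inj₂ (z≤ ∷≤ x≤-y)

-- The hyperplane copy is closed under taking faces, so collapses lift to it.
↘-onHyperplane : ∀ {n} {K L : Complex n} → K ↘ L → onHyperplane K ↘ onHyperplane L
↘-onHyperplane {K = K} {L} (done K≈L) = done same
  where
  same : onHyperplane K ≈ᶜ onHyperplane L
  same (𝟘 ∷ x) c = K≈L x c
  same (⊕ ∷ x) c = refl
  same (⊖ ∷ x) c = refl
↘-onHyperplane {K = K} (step σ τ ff rest) =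
  step (𝟘 ∷ σ) (𝟘 ∷ τ) ff-lift (↘-resp removed (↘-onHyperplane rest))
  where
  open FreeFace ff
  unique-lift : ∀ ρ → IsCell ρ → onHyperplane K ρ ≡ true → (𝟘 ∷ σ) ≺ ρ → ρ ≡ 𝟘 ∷ τ
  unique-lift (𝟘 ∷ ρ) c h (σ≼ρ , σ≢ρ) = cong (𝟘 ∷_) (unique ρ c h (≼-tail σ≼ρ , λ eq → σ≢ρ (cong (𝟘 ∷_) eq)))
  unique-lift (⊕ ∷ ρ) c () _
  unique-lift (⊖ ∷ ρ) () _ _
  ff-lift : FreeFace (onHyperplane K) (𝟘 ∷ σ) (𝟘 ∷ τ)
  ff-lift = record
    { σ-cell = σ-cell ; τ-cell = τ-cell ; σ∈K = σ∈K ; τ∈K = τ∈K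
    ; σ≺τ = ≼-cons (proj₁ σ≺τ) , (λ { refl → proj₂ σ≺τ refl })
    ; codim1 = codim1 ; unique = unique-lift }
  removed : remove (onHyperplane K) (𝟘 ∷ σ) (𝟘 ∷ τ) ≈ᶜ onHyperplane (remove K σ τ)
  removed (𝟘 ∷ x) c = remove-relabel (onHyperplane K) K (𝟘 ∷_) (λ { refl → refl }) σ τ x refl
  removed (⊕ ∷ x) c = remove-other (onHyperplane K) (𝟘 ∷ σ) (𝟘 ∷ τ) (⊕ ∷ x) (λ ()) (λ ())
  removed (⊖ ∷ x) c = remove-other (onHyperplane K) (𝟘 ∷ σ) (𝟘 ∷ τ) (⊖ ∷ x) (λ ()) (λ ())

-- If the cells of K beginning with ⊕ are ⊕ ∷ S for a clearable S, they can
-- be collapsed away without touching the cells beginning with 𝟘: every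
-- coface of a cell ⊕ ∷ σ is again of the form ⊕ ∷ ρ, so free pairs of S give
-- free faces of K.
collapse-⊕-cells : ∀ {N} {S : Complex N} → Clearable S → (K L : Complex (suc N)) →
  (∀ y → K (⊕ ∷ y) ≡ S y) → (∀ x → IsCell x → K (𝟘 ∷ x) ≡ L (𝟘 ∷ x)) →
  (∀ y → L (⊕ ∷ y) ≡ false) → K ↘ L
collapse-⊕-cells (empty S-empty) K L K⊕≡S K𝟘≡L𝟘 L⊕-empty = done same
  where
  same : K ≈ᶜ L
  same (𝟘 ∷ x) c = K𝟘≡L𝟘 x c
  same (⊕ ∷ y) c = trans (K⊕≡S y) (trans (S-empty y) (sym (L⊕-empty y)))
  same (⊖ ∷ y) ()
collapse-⊕-cells {S = S} (pair σ τ fp rest) K L K⊕≡S K𝟘≡L𝟘 L⊕-empty =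
  step (⊕ ∷ σ) (⊕ ∷ τ) ff
    (collapse-⊕-cells rest (remove K (⊕ ∷ σ) (⊕ ∷ τ)) L
      (λ y → remove-relabel K S (⊕ ∷_) (λ { refl → refl }) σ τ y (K⊕≡S y))
      (λ x c → trans (remove-other K (⊕ ∷ σ) (⊕ ∷ τ) (𝟘 ∷ x) (λ ()) (λ ())) (K𝟘≡L𝟘 x c))
      L⊕-empty)
  where
  open FreePair fp
  unique-⊕ : ∀ ρ → IsCell ρ → K ρ ≡ true → (⊕ ∷ σ) ≺ ρ → ρ ≡ ⊕ ∷ τ
  unique-⊕ (⊕ ∷ ρ) _ h (inj₁ (s≤s ∷≤ σ≤ρ) , σ≢ρ) =
    cong (⊕ ∷_) (unique ρ (trans (sym (K⊕≡S ρ)) h) σ≤ρ (λ eq → σ≢ρ (cong (⊕ ∷_) eq)))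
  unique-⊕ (⊕ ∷ ρ) _ _ (inj₂ (() ∷≤ _) , _)
  unique-⊕ (𝟘 ∷ ρ) _ _ (inj₁ (() ∷≤ _) , _)
  unique-⊕ (𝟘 ∷ ρ) _ _ (inj₂ (() ∷≤ _) , _)
  unique-⊕ (⊖ ∷ ρ) () _ _
  ff : FreeFace K (⊕ ∷ σ) (⊕ ∷ τ)
  ff = record
    { σ-cell = refl ; τ-cell = refl
    ; σ∈K = trans (K⊕≡S σ) σ∈S ; τ∈K = trans (K⊕≡S τ) τ∈S
    ; σ≺τ = inj₁ (s≤s ∷≤ σ≤τ) , (λ { refl → σ≢τ refl })
    ; codim1 = cong suc codim1 ; unique = unique-⊕ }

grVar-peel : ∀ N m → m < N → GrVar (suc N) m ↘ onHyperplane (GrVar N m)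
grVar-peel (suc N) m (s≤s m≤N) =
  collapse-⊕-cells (lowVar-clearable ⊕≢𝟘 m N m≤N) (GrVar (suc (suc N)) m) (onHyperplane (GrVar (suc N) m))
    (λ _ → refl) (λ _ _ → refl) (λ _ → refl)

-- Face posets.  A vector of length m+1 has at most m sign changes, so
-- Gr^{var≤m}_{1,m+1} consists of all cells of RP^m.

varAux-≤ : ∀ {n} l (x : Vec Sign n) → varAux l x ≤ n
varAux-≤ l [] = z≤n
varAux-≤ l (𝟘 ∷ x) = m≤n⇒m≤1+n (varAux-≤ l x)
varAux-≤ nothing (⊕ ∷ x) = m≤n⇒m≤1+n (varAux-≤ (just ⊕) x)
varAux-≤ nothing (⊖ ∷ x) = m≤n⇒m≤1+n (varAux-≤ (just ⊖) x)
varAux-≤ (just 𝟘) (⊕ ∷ x) = m≤n⇒m≤1+n (varAux-≤ (just ⊕) x)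
varAux-≤ (just 𝟘) (⊖ ∷ x) = m≤n⇒m≤1+n (varAux-≤ (just ⊖) x)
varAux-≤ (just ⊕) (⊕ ∷ x) = m≤n⇒m≤1+n (varAux-≤ (just ⊕) x)
varAux-≤ (just ⊕) (⊖ ∷ x) = s≤s (varAux-≤ (just ⊖) x)
varAux-≤ (just ⊖) (⊕ ∷ x) = s≤s (varAux-≤ (just ⊕) x)
varAux-≤ (just ⊖) (⊖ ∷ x) = m≤n⇒m≤1+n (varAux-≤ (just ⊖) x)

var-≤ : ∀ {m} (x : Vec Sign (suc m)) → var x ≤ m
var-≤ (𝟘 ∷ x) = varAux-≤ nothing x
var-≤ (⊕ ∷ x) = varAux-≤ (just ⊕) x
var-≤ (⊖ ∷ x) = varAux-≤ (just ⊖) x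

grVar-all : ∀ m → FacePosetIsoRP (GrVar (suc m) m) m
grVar-all m = record
  { to = λ { (x , c , _) → x , c }
  ; from = λ { (x , c) → x , c , member x c }
  ; to-from = λ _ → refl
  ; from-to = λ _ → refl
  ; mono = λ _ _ x≼y → x≼y
  ; reflect = λ _ _ x≼y → x≼y }
  where
  member : ∀ x → IsCell x → GrVar (suc m) m x ≡ true
  member x c rewrite c = ≤⇒≤ᵇ-true (var-≤ x)

iso-onHyperplane : ∀ {n} {L : Complex n} {m} → FacePosetIsoRP L m → FacePosetIsoRP (onHyperplane L) m
iso-onHyperplane {L = L} {m} I = record
  { to = to ; from = from ; to-from = I.to-from ; from-to = from-to ; mono = mono ; reflect = reflect }
  where
  module I = FacePosetIsoRP I
  to : CellsOf (onHyperplane L) → RPCells m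
  to ((𝟘 ∷ x) , c , l) = I.to (x , c , l)
  to ((⊕ ∷ x) , c , ())
  to ((⊖ ∷ x) , () , l)
  from : RPCells m → CellsOf (onHyperplane L)
  from y with I.from y
  ... | x , c , l = (𝟘 ∷ x) , c , l
  from-to : ∀ x → proj₁ (from (to x)) ≡ proj₁ x
  from-to ((𝟘 ∷ x) , c , l) = cong (𝟘 ∷_) (I.from-to (x , c , l))
  from-to ((⊕ ∷ x) , c , ())
  from-to ((⊖ ∷ x) , () , l)
  mono : ∀ a b → proj₁ a ≼ proj₁ b → proj₁ (to a) ≼ proj₁ (to b)
  mono ((𝟘 ∷ x) , c , l) ((𝟘 ∷ y) , c' , l') x≼y = I.mono (x , c , l) (y , c' , l') (≼-tail x≼y)
  mono ((⊕ ∷ x) , c , ()) _ _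
  mono ((⊖ ∷ x) , () , l) _ _
  mono ((𝟘 ∷ x) , c , l) ((⊕ ∷ y) , c' , ()) _
  mono ((𝟘 ∷ x) , c , l) ((⊖ ∷ y) , () , l') _
  reflect : ∀ a b → proj₁ (to a) ≼ proj₁ (to b) → proj₁ a ≼ proj₁ b
  reflect ((𝟘 ∷ x) , c , l) ((𝟘 ∷ y) , c' , l') x≼y = ≼-cons (I.reflect (x , c , l) (y , c' , l') x≼y)
  reflect ((⊕ ∷ x) , c , ()) _ _
  reflect ((⊖ ∷ x) , () , l) _ _
  reflect ((𝟘 ∷ x) , c , l) ((⊕ ∷ y) , c' , ()) _
  reflect ((𝟘 ∷ x) , c , l) ((⊖ ∷ y) , () , l') _

collapse-onto-RP : ∀ n m → m < n → Σ (Complex n) λ L → (GrVar n m ↘ L) × FacePosetIsoRP L m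
collapse-onto-RP (suc n) m m<1+n with m<1+n⇒m<n∨m≡n m<1+n
... | inj₂ refl = GrVar (suc m) m , done (λ _ _ → refl) , grVar-all m
... | inj₁ m<n with collapse-onto-RP n m m<n
...   | L , GrVar↘L , L≅RP =
  onHyperplane L , ↘-trans (grVar-peel n m m<n) (↘-onHyperplane GrVar↘L) , iso-onHyperplane L≅RP

theorem3p6 : (n m : ℕ) → 1 ≤ n → m < n →
    Σ (Complex n) λ L → (GrVar n m ↘ L) × FacePosetIsoRP L m
theorem3p6 n m _ m<n = collapse-onto-RP n m m<n
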